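{- Let $\mathcal{B}$ be an $s$-$(k,t,\lambda)$ design and let $B\in\mathcal{B}$. Let $d=|\{B'\in\mathcal{B}\setminus\{B\}: B\cap B'\neq\emptyset\}|$ (counted with multiplicity, with $B$ itself removed once). Then \[ d\;\le\;\sum_{i=1}^{2\lfloor\frac{s-1}{2}\rfloor+1}(-1)^{i+1}\binom{t}{i}\left(\frac{\lambda\binom{k-i}{s-i}}{\binom{t-i}{s-i}}-1\right). \] Moreover, for every odd $m$ with $1\le m\le s$, \[ d\;\le\;\sum_{i=1}^{m}(-1)^{i+1}\binom{t}{i}\left(\frac{\lambda\binom{k-i}{s-i}}{\binom{t-i}{s-i}}-1\right). \] Furthermore, when $s=t-1$ and the design has no repeated blocks, \[ d=\sum_{i=1}^{t-1}(-1)^{i+1}\binom{t}{i}\left(\frac{\lambda\binom{k-i}{(t-1)-i}}{t-i}-1\right). \]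
   Context: An $s$-$(k,t,\lambda)$ design is a collection $\mathcal{B}$ (possibly with repetitions) of $t$-subsets, called blocks, of a $k$-set $V$ such that every $s$-subset of $V$ is contained in exactly $\lambda$ blocks of $\mathcal{B}$. -}

module Defs where

open import Data.Nat using (ℕ; zero; suc; _∸_; _≡ᵇ_)
open import Data.Nat.Combinatorics using (_C_)
open import Data.Integer as ℤ using (ℤ; +_; -1ℤ)
open import Data.Rational as ℚ using (ℚ; _/_; 0ℚ; 1ℚ)
open import Data.Fin using (Fin)
open import Data.Fin.Subset using (Subset; _⊆_; _∩_; ∣_∣; Nonempty)
open import Data.Fin.Subset.Properties using (_⊆?_; nonempty?)
open import Data.List using (List; filter; removeAt; lookup; length)
open import Data.List.Relation.Unary.All using (All)
open import Data.Product using (_×_)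
open import Relation.Binary.PropositionalEquality using (_≡_)

-- Blocks of a design on the point set V = Fin k: a list (multiset) of subsets.

occurrences : {k : ℕ} → Subset k → List (Subset k) → ℕ
occurrences S 𝓑 = length (filter (S ⊆?_) 𝓑)

IsDesign : (s k t lam : ℕ) → List (Subset k) → Set
IsDesign s k t lam 𝓑 =
  All (λ B → ∣ B ∣ ≡ t) 𝓑 ×
  ((S : Subset k) → ∣ S ∣ ≡ s → occurrences S 𝓑 ≡ lam)

degree : {k : ℕ} (𝓑 : List (Subset k)) → Fin (length 𝓑) → ℕ
degree 𝓑 j = length (filter (λ B′ → nonempty? (lookup 𝓑 j ∩ B′)) (removeAt 𝓑 j))

-- a / b as a rational; the value for b = 0 is a junk value never used
-- (the denominators below are nonzero under the hypotheses).
frac : ℕ → ℕ → ℚ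
frac a zero    = 0ℚ
frac a (suc b) = (+ a) / suc b

sgn : ℕ → ℚ
sgn i = (-1ℤ ℤ.^ suc i) / 1

sum1to : ℕ → (ℕ → ℚ) → ℚ
sum1to zero    f = 0ℚ
sum1to (suc m) f = sum1to m f ℚ.+ f (suc m)

term : (s k t lam i : ℕ) → ℚ
term s k t lam i =
  sgn i ℚ.* ((+ (t C i)) / 1) ℚ.*
    (frac (lam ℕ.* ((k ∸ i) C (s ∸ i))) ((t ∸ i) C (s ∸ i)) ℚ.- 1ℚ)
  where import Data.Nat as ℕ

term′ : (k t lam i : ℕ) → ℚ
term′ k t lam i =
  sgn i ℚ.* ((+ (t C i)) / 1) ℚ.*
    (frac (lam ℕ.* ((k ∸ i) C ((t ∸ 1) ∸ i))) (t ∸ i) ℚ.- 1ℚ)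
  where import Data.Nat as ℕ

-- Fix the block B and write a(B′) = |B ∩ B′|.  Counting in two ways the triples (I, S, B′) with
-- I an i-subset of B, S an s-set and I ⊆ S ⊆ B′ ∈ 𝓑 gives
--   ∑_{B′ ∈ 𝓑} C(a(B′), i) C(t−i, s−i) = C(t,i) λ C(k−i, s−i),
-- and removing B itself (a(B) = t) leaves ∑_{B′ ≠ B} C(a(B′), i) = C(t,i) (λ C(k−i, s−i) / C(t−i, s−i) − 1).
-- Exchanging the two sums, the right-hand side with m terms equals ∑_{B′ ≠ B} h_m(a(B′)), where
-- h_m(a) = ∑_{i=1}^m (−1)^(i+1) C(a,i) = 1 − (−1)^m C(a−1, m) for a ≥ 1 and h_m(0) = 0.
-- For odd m this is at least [a > 0], and d = ∑_{B′ ≠ B} [a(B′) > 0].  When s = t − 1 and there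
-- are no repeated blocks, every a(B′) ≤ t − 1 = m, so C(a − 1, m) = 0 and h_m(a) = [a > 0].
module Submission where

open import Algebra.Bundles using (CommutativeSemiring)
open import Data.Fin using (Fin; zero; suc)
open import Data.List using (List; []; _∷_; _++_; _∷ʳ_; map; lookup; removeAt; length)
open import Data.List.Relation.Unary.All using (All; []; _∷_)
open import Level using (Level)

module ListSum {c ℓ} (R : CommutativeSemiring c ℓ) where
  open CommutativeSemiring R
  open import Algebra.Properties.CommutativeSemigroup +-commutativeSemigroup
    using (x∙yz≈y∙xz) renaming (interchange to +-interchange)

  private
    variable
      a : Level
      A B : Set a

  ∑ : List A → (A → Carrier) → Carrier
  ∑ []       f = 0#
  ∑ (x ∷ xs) f = f x + ∑ xs f

  ∑-cong : ∀ (xs : List A) {f g : A → Carrier} → (∀ x → f x ≈ g x) → ∑ xs f ≈ ∑ xs g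
  ∑-cong []       f≈g = refl
  ∑-cong (x ∷ xs) f≈g = +-cong (f≈g x) (∑-cong xs f≈g)

  ∑-congᴬ : ∀ {p} {P : A → Set p} {xs : List A} {f g : A → Carrier} →
            All P xs → (∀ {x} → P x → f x ≈ g x) → ∑ xs f ≈ ∑ xs g
  ∑-congᴬ []         f≈g = refl
  ∑-congᴬ (px ∷ pxs) f≈g = +-cong (f≈g px) (∑-congᴬ pxs f≈g)

  ∑-0 : ∀ (xs : List A) → ∑ xs (λ _ → 0#) ≈ 0#
  ∑-0 []       = refl
  ∑-0 (x ∷ xs) = trans (+-identityˡ _) (∑-0 xs)

  ∑-++ : ∀ (xs ys : List A) f → ∑ (xs ++ ys) f ≈ ∑ xs f + ∑ ys f
  ∑-++ []       ys f = sym (+-identityˡ _)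
  ∑-++ (x ∷ xs) ys f = trans (+-congˡ (∑-++ xs ys f)) (sym (+-assoc _ _ _))

  ∑-∷ʳ : ∀ (xs : List A) x f → ∑ (xs ∷ʳ x) f ≈ ∑ xs f + f x
  ∑-∷ʳ xs x f = trans (∑-++ xs _ f) (+-congˡ (+-identityʳ (f x)))

  ∑-map : ∀ (g : A → B) (xs : List A) f → ∑ (map g xs) f ≈ ∑ xs (λ x → f (g x))
  ∑-map g []       f = refl
  ∑-map g (x ∷ xs) f = +-congˡ (∑-map g xs f)

  ∑-+ : ∀ (xs : List A) f g → ∑ xs (λ x → f x + g x) ≈ ∑ xs f + ∑ xs g
  ∑-+ []       f g = sym (+-identityˡ 0#)
  ∑-+ (x ∷ xs) f g = trans (+-congˡ (∑-+ xs f g)) (+-interchange _ _ _ _)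

  ∑-*ˡ : ∀ c (xs : List A) f → ∑ xs (λ x → c * f x) ≈ c * ∑ xs f
  ∑-*ˡ c []       f = sym (zeroʳ c)
  ∑-*ˡ c (x ∷ xs) f = trans (+-congˡ (∑-*ˡ c xs f)) (sym (distribˡ c _ _))

  ∑-*ʳ : ∀ c (xs : List A) f → ∑ xs (λ x → f x * c) ≈ ∑ xs f * c
  ∑-*ʳ c xs f =
    trans (∑-cong xs (λ x → *-comm (f x) c)) (trans (∑-*ˡ c xs f) (*-comm c _))

  ∑-swap : ∀ (xs : List A) (ys : List B) (f : A → B → Carrier) →
           ∑ xs (λ x → ∑ ys (f x)) ≈ ∑ ys (λ y → ∑ xs (λ x → f x y))
  ∑-swap []       ys f = sym (∑-0 ys)
  ∑-swap (x ∷ xs) ys f =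
    trans (+-congˡ (∑-swap xs ys f)) (sym (∑-+ ys (f x) _))

  ∑-removeAt : ∀ (xs : List A) (j : Fin (length xs)) f →
               ∑ xs f ≈ f (lookup xs j) + ∑ (removeAt xs j) f
  ∑-removeAt (x ∷ xs) zero    f = refl
  ∑-removeAt (x ∷ xs) (suc j) f =
    trans (+-congˡ (∑-removeAt xs j f)) (x∙yz≈y∙xz (f x) _ _)

open import Data.Bool using (true; false; if_then_else_)
open import Data.Fin.Subset using (Subset; _∩_; ∣_∣; inside; outside; ⊤)
open import Data.Fin.Subset.Properties
  using (_⊆?_; ⊆⊤; ∣p∩q∣≤∣p∣; ∣p∩q∣≤∣q∣; ∣⊤∣≡n; ∩-identityʳ; ∩-idem; nonempty?; Empty-unique; ∣⊥∣≡0;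
         x∈p⇒∣p-x∣<∣p∣)
open import Data.Integer as ℤ using (ℤ; +_; -1ℤ; 0ℤ; 1ℤ)
import Data.Integer.Properties as ℤP
open import Data.Integer.Tactic.RingSolver using (solve-∀)
open import Data.List using (filter; applyUpTo)
open import Data.List.Properties using (applyUpTo-∷ʳ)
open import Data.List.Membership.Propositional.Properties using (∈-lookup)
import Data.List.Relation.Unary.All as All
import Data.List.Relation.Unary.All.Properties as All
open import Data.List.Relation.Unary.AllPairs using (_∷_)
open import Data.List.Relation.Unary.Unique.Propositional using (Unique)
open import Data.Nat as ℕ
open import Data.Nat.Combinatorics using (_C_; k>n⇒nCk≡0; nCk+nC[k+1]≡[n+1]C[k+1]; nCk≡nC[n∸k]; nC1≡n)
open import Data.Nat.Properties
open import Data.Product using (_×_; _,_; proj₁; ∃)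
open import Data.Rational as ℚ using (ℚ; 1ℚ)
import Data.Rational.Properties as ℚP
open import Data.Rational.Unnormalised as ℚᵘ using (mkℚᵘ; *≡*; *≤*)
import Data.Rational.Unnormalised.Properties as ℚᵘP
open import Data.Vec using ([]; _∷_)
open import Relation.Binary.PropositionalEquality
open import Relation.Nullary using (Dec; yes; no; does; contradiction)
open import Relation.Unary using (Pred; Decidable)

open import Defs using (IsDesign; occurrences; degree; sum1to; frac; sgn; term; term′)

open ListSum +-*-commutativeSemiring
open import Algebra.Properties.CommutativeSemigroup *-commutativeSemigroup using (x∙yz≈y∙xz)
open ℚᵘP using (module ≃-Reasoning)

indicator : ∀ {p} {P : Set p} → Dec P → ℕ
indicator d = if does d then 1 else 0

indicator-yes : ∀ {p} {P : Set p} (d : Dec P) → P → indicator d ≡ 1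
indicator-yes (yes _) _ = refl
indicator-yes (no ¬p) p = contradiction p ¬p

length-filter≡∑indicator : ∀ {a p} {A : Set a} {P : Pred A p} (P? : Decidable P) xs →
                           length (filter P? xs) ≡ ∑ xs (λ x → indicator (P? x))
length-filter≡∑indicator P? []       = refl
length-filter≡∑indicator P? (x ∷ xs) with does (P? x)
... | false = length-filter≡∑indicator P? xs
... | true  = cong suc (length-filter≡∑indicator P? xs)

signum : ℕ → ℕ
signum zero    = 0
signum (suc _) = 1

indicator-nonempty : ∀ {n} (X : Subset n) → indicator (nonempty? X) ≡ signum ∣ X ∣
indicator-nonempty {n} X with nonempty? X
... | yes (x , x∈X) = sym (signum-pos (≤-<-trans z≤n (x∈p⇒∣p-x∣<∣p∣ x∈X)))
  where
  signum-pos : ∀ {n} → 0 < n → signum n ≡ 1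
  signum-pos (s≤s _) = refl
... | no ¬nonempty = cong signum (sym (trans (cong ∣_∣ (Empty-unique ¬nonempty)) (∣⊥∣≡0 n)))

subsetsOfSize : (n m : ℕ) → List (Subset n)
subsetsOfSize zero    zero    = [] ∷ []
subsetsOfSize zero    (suc m) = []
subsetsOfSize (suc n) zero    = map (outside ∷_) (subsetsOfSize n zero)
subsetsOfSize (suc n) (suc m) =
  map (outside ∷_) (subsetsOfSize n (suc m)) ++ map (inside ∷_) (subsetsOfSize n m)

subsetsOfSize-∣∣ : ∀ n m → All (λ S → ∣ S ∣ ≡ m) (subsetsOfSize n m)
subsetsOfSize-∣∣ zero    zero    = refl ∷ []
subsetsOfSize-∣∣ zero    (suc m) = []
subsetsOfSize-∣∣ (suc n) zero    = All.map⁺ (subsetsOfSize-∣∣ n zero)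
subsetsOfSize-∣∣ (suc n) (suc m) = All.++⁺ (All.map⁺ (subsetsOfSize-∣∣ n (suc m)))
  (All.map⁺ (All.map (cong suc) (subsetsOfSize-∣∣ n m)))

∣p∩q∣≡∣p∣≡∣q∣⇒p≡q : ∀ {n} (p q : Subset n) → ∣ p ∩ q ∣ ≡ ∣ p ∣ → ∣ p ∩ q ∣ ≡ ∣ q ∣ → p ≡ q
∣p∩q∣≡∣p∣≡∣q∣⇒p≡q []            []            _  _  = refl
∣p∩q∣≡∣p∣≡∣q∣⇒p≡q (outside ∷ p) (outside ∷ q) e₁ e₂ = cong (outside ∷_) (∣p∩q∣≡∣p∣≡∣q∣⇒p≡q p q e₁ e₂)
∣p∩q∣≡∣p∣≡∣q∣⇒p≡q (inside ∷ p)  (inside ∷ q)  e₁ e₂ =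
  cong (inside ∷_) (∣p∩q∣≡∣p∣≡∣q∣⇒p≡q p q (suc-injective e₁) (suc-injective e₂))
∣p∩q∣≡∣p∣≡∣q∣⇒p≡q (inside ∷ p)  (outside ∷ q) e₁ _  = contradiction e₁ (<⇒≢ (s≤s (∣p∩q∣≤∣p∣ p q)))
∣p∩q∣≡∣p∣≡∣q∣⇒p≡q (outside ∷ p) (inside ∷ q)  _  e₂ = contradiction e₂ (<⇒≢ (s≤s (∣p∩q∣≤∣q∣ p q)))

weight : ∀ {n} → Subset n → Subset n → List (Subset n) → ℕ → ℕ
weight B Y Ss i = ∑ Ss (λ S → indicator (S ⊆? Y) * (∣ B ∩ S ∣ C i))

weight-vanishes : ∀ {n} (B Y : Subset n) {m i} → m < i → weight B Y (subsetsOfSize n m) i ≡ 0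
weight-vanishes {n} B Y {m} {i} m<i =
  trans (∑-congᴬ (subsetsOfSize-∣∣ n m) (λ {S} → term≡0 {S})) (∑-0 (subsetsOfSize n m))
  where
  term≡0 : ∀ {S} → ∣ S ∣ ≡ m → indicator (S ⊆? Y) * (∣ B ∩ S ∣ C i) ≡ 0
  term≡0 {S} refl = trans (cong (indicator (S ⊆? Y) *_) (k>n⇒nCk≡0 (≤-<-trans (∣p∩q∣≤∣q∣ B S) m<i)))
                          (*-zeroʳ (indicator (S ⊆? Y)))

weight-++ : ∀ {n} (B Y : Subset n) Ss Ts i → weight B Y (Ss ++ Ts) i ≡ weight B Y Ss i + weight B Y Ts i
weight-++ B Y Ss Ts i = ∑-++ Ss Ts _

weight-outside : ∀ {n} b y (B Y : Subset n) Ss i →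
                 weight (b ∷ B) (y ∷ Y) (map (outside ∷_) Ss) i ≡ weight B Y Ss i
weight-outside outside y B Y Ss i = ∑-map _ Ss _
weight-outside inside  y B Y Ss i = ∑-map _ Ss _

weight-excluded : ∀ {n} b (B Y : Subset n) Ss i →
                  weight (b ∷ B) (outside ∷ Y) (map (inside ∷_) Ss) i ≡ 0
weight-excluded b B Y Ss i = trans (∑-map _ Ss _) (∑-0 Ss)

weight-fresh : ∀ {n} (B Y : Subset n) Ss i →
               weight (outside ∷ B) (inside ∷ Y) (map (inside ∷_) Ss) i ≡ weight B Y Ss i
weight-fresh B Y Ss i = ∑-map _ Ss _

weight-shared : ∀ {n} (B Y : Subset n) Ss i →
                weight (inside ∷ B) (inside ∷ Y) (map (inside ∷_) Ss) (suc i) ≡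
                weight B Y Ss (suc i) + weight B Y Ss i
weight-shared B Y Ss i = begin
  weight (inside ∷ B) (inside ∷ Y) (map (inside ∷_) Ss) (suc i)
    ≡⟨ ∑-map (inside ∷_) Ss _ ⟩
  ∑ Ss (λ S → indicator (S ⊆? Y) * (suc ∣ B ∩ S ∣ C suc i))
    ≡⟨ ∑-cong Ss pascal ⟩
  ∑ Ss (λ S → indicator (S ⊆? Y) * (∣ B ∩ S ∣ C suc i) + indicator (S ⊆? Y) * (∣ B ∩ S ∣ C i))
    ≡⟨ ∑-+ Ss _ _ ⟩
  weight B Y Ss (suc i) + weight B Y Ss i ∎
  where
  open ≡-Reasoning
  pascal : ∀ S → indicator (S ⊆? Y) * (suc ∣ B ∩ S ∣ C suc i) ≡
                 indicator (S ⊆? Y) * (∣ B ∩ S ∣ C suc i) + indicator (S ⊆? Y) * (∣ B ∩ S ∣ C i)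
  pascal S = trans (cong (indicator (S ⊆? Y) *_)
                      (trans (sym (nCk+nC[k+1]≡[n+1]C[k+1] ∣ B ∩ S ∣ i)) (+-comm (∣ B ∩ S ∣ C i) _)))
                   (*-distribˡ-+ (indicator (S ⊆? Y)) _ _)

C*pascal : ∀ {a y} i r → a ≤ y →
           (a C i) * ((y ∸ i) C suc r) + (a C i) * ((y ∸ i) C r) ≡ (a C i) * ((suc y ∸ i) C suc r)
C*pascal {a} {y} i r a≤y with i ≤? y
... | yes i≤y = begin
  (a C i) * ((y ∸ i) C suc r) + (a C i) * ((y ∸ i) C r)
    ≡⟨ *-distribˡ-+ (a C i) _ _ ⟨
  (a C i) * ((y ∸ i) C suc r + (y ∸ i) C r)
    ≡⟨ cong ((a C i) *_) pascal ⟩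
  (a C i) * (suc (y ∸ i) C suc r)
    ≡⟨ cong (λ x → (a C i) * (x C suc r)) (+-∸-assoc 1 i≤y) ⟨
  (a C i) * ((suc y ∸ i) C suc r) ∎
  where
  open ≡-Reasoning
  pascal : (y ∸ i) C suc r + (y ∸ i) C r ≡ suc (y ∸ i) C suc r
  pascal = trans (+-comm ((y ∸ i) C suc r) _) (nCk+nC[k+1]≡[n+1]C[k+1] (y ∸ i) r)
... | no i≰y rewrite k>n⇒nCk≡0 (≤-<-trans a≤y (≰⇒> i≰y)) = refl

-- Each i-subset of B ∩ Y lies in C(|Y| − i, r) subsets of Y of size i + r.
WeightIdentity : ∀ {n} → Subset n → Subset n → Set
WeightIdentity {n} B Y = ∀ i r {m} → i + r ≡ m →
  weight B Y (subsetsOfSize n m) i ≡ (∣ B ∩ Y ∣ C i) * ((∣ Y ∣ ∸ i) C r)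

weight-identity-[] : WeightIdentity [] []
weight-identity-[] zero    zero    refl = refl
weight-identity-[] zero    (suc r) refl = refl
weight-identity-[] (suc i) r       refl = refl

module _ {n} {B Y : Subset n} (ih : WeightIdentity B Y) where

  private
    W : ℕ → ℕ → ℕ
    W m i = weight B Y (subsetsOfSize n m) i

    outsides insides : ℕ → List (Subset (suc n))
    outsides m = map (outside ∷_) (subsetsOfSize n m)
    insides  m = map (inside ∷_) (subsetsOfSize n m)

  weight-identity-outside : ∀ b → WeightIdentity (b ∷ B) (outside ∷ Y)
  weight-identity-outside b i r {m} eq =
    trans (restrict m) (trans (ih i r eq) (cong (λ a → (a C i) * ((∣ Y ∣ ∸ i) C r)) (∣∩outside∣ b)))
    where
    restrict : ∀ m → weight (b ∷ B) (outside ∷ Y) (subsetsOfSize (suc n) m) i ≡ W m i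
    restrict zero    = weight-outside b outside B Y (subsetsOfSize n zero) i
    restrict (suc m) = begin
      weight (b ∷ B) (outside ∷ Y) (outsides (suc m) ++ insides m) i
        ≡⟨ weight-++ (b ∷ B) (outside ∷ Y) (outsides (suc m)) (insides m) i ⟩
      weight (b ∷ B) (outside ∷ Y) (outsides (suc m)) i + weight (b ∷ B) (outside ∷ Y) (insides m) i
        ≡⟨ cong₂ _+_ (weight-outside b outside B Y (subsetsOfSize n (suc m)) i)
                     (weight-excluded b B Y (subsetsOfSize n m) i) ⟩
      W (suc m) i + 0
        ≡⟨ +-identityʳ (W (suc m) i) ⟩
      W (suc m) i ∎
      where open ≡-Reasoning
    ∣∩outside∣ : ∀ b → ∣ B ∩ Y ∣ ≡ ∣ (b ∷ B) ∩ (outside ∷ Y) ∣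
    ∣∩outside∣ outside = refl
    ∣∩outside∣ inside  = refl

  private
    split-inside : ∀ b m i →
      weight (b ∷ B) (inside ∷ Y) (subsetsOfSize (suc n) (suc m)) i ≡
      W (suc m) i + weight (b ∷ B) (inside ∷ Y) (insides m) i
    split-inside b m i =
      trans (weight-++ (b ∷ B) (inside ∷ Y) (outsides (suc m)) (insides m) i)
            (cong (_+ weight (b ∷ B) (inside ∷ Y) (insides m) i)
                  (weight-outside b inside B Y (subsetsOfSize n (suc m)) i))

    extend : ∀ i r {m} → i + r ≡ suc m →
             W (suc m) i + W m i ≡ (∣ B ∩ Y ∣ C i) * ((suc ∣ Y ∣ ∸ i) C r)
    extend i (suc r) eq =
      trans (cong₂ _+_ (ih i (suc r) eq) (ih i r (suc-injective (trans (sym (+-suc i r)) eq))))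
            (C*pascal i r (∣p∩q∣≤∣q∣ B Y))
    extend i zero {m} eq =
      trans (cong₂ _+_ (ih i zero eq) (weight-vanishes B Y m<i)) (+-identityʳ _)
      where
      m<i : m < i
      m<i = subst (m <_) (trans (sym eq) (+-identityʳ i)) (n<1+n m)

  weight-identity-fresh : WeightIdentity (outside ∷ B) (inside ∷ Y)
  weight-identity-fresh zero zero {zero} refl =
    trans (weight-outside outside inside B Y (subsetsOfSize n 0) 0) (ih 0 0 refl)
  weight-identity-fresh i r {suc m} eq =
    trans (split-inside outside m i)
          (trans (cong (W (suc m) i ℕ.+_) (weight-fresh B Y (subsetsOfSize n m) i)) (extend i r eq))

  weight-identity-shared : WeightIdentity (inside ∷ B) (inside ∷ Y)
  weight-identity-shared zero zero {zero} refl =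
    trans (weight-outside inside inside B Y (subsetsOfSize n 0) 0) (ih 0 0 refl)
  weight-identity-shared zero r {suc m} eq =
    -- C (suc x) 0 and C x 0 both compute to 1
    trans (split-inside inside m 0)
          (trans (cong (W (suc m) 0 ℕ.+_) (∑-map (inside ∷_) (subsetsOfSize n m) _)) (extend 0 r eq))
  weight-identity-shared (suc i) r {suc m} eq = begin
    weight (inside ∷ B) (inside ∷ Y) (subsetsOfSize (suc n) (suc m)) (suc i)
      ≡⟨ split-inside inside m (suc i) ⟩
    W (suc m) (suc i) + weight (inside ∷ B) (inside ∷ Y) (insides m) (suc i)
      ≡⟨ cong (W (suc m) (suc i) ℕ.+_) (weight-shared B Y (subsetsOfSize n m) i) ⟩
    W (suc m) (suc i) + (W m (suc i) + W m i)
      ≡⟨ +-assoc (W (suc m) (suc i)) _ _ ⟨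
    (W (suc m) (suc i) + W m (suc i)) + W m i
      ≡⟨ cong₂ _+_ (extend (suc i) r eq) (ih i r (suc-injective eq)) ⟩
    (a C suc i) * ((y ∸ i) C r) + (a C i) * ((y ∸ i) C r)
      ≡⟨ *-distribʳ-+ ((y ∸ i) C r) (a C suc i) _ ⟨
    (a C suc i + a C i) * ((y ∸ i) C r)
      ≡⟨ cong (_* ((y ∸ i) C r)) (trans (+-comm (a C suc i) _) (nCk+nC[k+1]≡[n+1]C[k+1] a i)) ⟩
    (suc a C suc i) * ((y ∸ i) C r)
      ∎
    where
    open ≡-Reasoning
    a y : ℕ
    a = ∣ B ∩ Y ∣
    y = ∣ Y ∣

weight-identity : ∀ {n} (B Y : Subset n) → WeightIdentity B Y
weight-identity []            []            = weight-identity-[]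
weight-identity (b ∷ B)       (outside ∷ Y) = weight-identity-outside (weight-identity B Y) b
weight-identity (outside ∷ B) (inside ∷ Y)  = weight-identity-fresh (weight-identity B Y)
weight-identity (inside ∷ B)  (inside ∷ Y)  = weight-identity-shared (weight-identity B Y)

∑-weight≡∑-occurrences : ∀ {n} (𝓑 : List (Subset n)) B Ss i →
  ∑ 𝓑 (λ B′ → weight B B′ Ss i) ≡ ∑ Ss (λ S → occurrences S 𝓑 * (∣ B ∩ S ∣ C i))
∑-weight≡∑-occurrences 𝓑 B Ss i = trans (∑-swap 𝓑 Ss _) (∑-cong Ss count)
  where
  count : ∀ S → ∑ 𝓑 (λ B′ → indicator (S ⊆? B′) * (∣ B ∩ S ∣ C i)) ≡ occurrences S 𝓑 * (∣ B ∩ S ∣ C i)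
  count S = trans (∑-*ʳ (∣ B ∩ S ∣ C i) 𝓑 _)
                  (cong (_* (∣ B ∩ S ∣ C i)) (sym (length-filter≡∑indicator (S ⊆?_) 𝓑)))

weight-⊤ : ∀ {n} (B : Subset n) Ss i → weight B ⊤ Ss i ≡ ∑ Ss (λ S → ∣ B ∩ S ∣ C i)
weight-⊤ B Ss i = ∑-cong Ss (λ S → trans (cong (_* (∣ B ∩ S ∣ C i)) (indicator-yes (S ⊆? ⊤) ⊆⊤))
                                         (*-identityˡ (∣ B ∩ S ∣ C i)))

design-intersections : ∀ {s k t lam 𝓑} → IsDesign s k t lam 𝓑 →
  ∀ {B} → ∣ B ∣ ≡ t → ∀ i r → i + r ≡ s →
  ∑ 𝓑 (λ B′ → ∣ B ∩ B′ ∣ C i) * ((t ∸ i) C r) ≡ (t C i) * (lam * ((k ∸ i) C r))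
design-intersections {s} {k} {t} {lam} {𝓑} (blockSizes , λ-covers) {B} ∣B∣≡t i r i+r≡s = begin
  ∑ 𝓑 (λ B′ → ∣ B ∩ B′ ∣ C i) * ((t ∸ i) C r)
    ≡⟨ ∑-*ʳ ((t ∸ i) C r) 𝓑 _ ⟨
  ∑ 𝓑 (λ B′ → (∣ B ∩ B′ ∣ C i) * ((t ∸ i) C r))
    ≡⟨ ∑-congᴬ blockSizes (λ { refl → refl }) ⟩
  ∑ 𝓑 (λ B′ → (∣ B ∩ B′ ∣ C i) * ((∣ B′ ∣ ∸ i) C r))
    ≡⟨ ∑-cong 𝓑 (λ B′ → weight-identity B B′ i r i+r≡s) ⟨
  ∑ 𝓑 (λ B′ → weight B B′ Ss i)
    ≡⟨ ∑-weight≡∑-occurrences 𝓑 B Ss i ⟩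
  ∑ Ss (λ S → occurrences S 𝓑 * (∣ B ∩ S ∣ C i))
    ≡⟨ ∑-congᴬ (subsetsOfSize-∣∣ k s) (λ ∣S∣≡s → cong (_* _) (λ-covers _ ∣S∣≡s)) ⟩
  ∑ Ss (λ S → lam * (∣ B ∩ S ∣ C i))
    ≡⟨ ∑-*ˡ lam Ss _ ⟩
  lam * ∑ Ss (λ S → ∣ B ∩ S ∣ C i)
    ≡⟨ cong (lam *_) (weight-⊤ B Ss i) ⟨
  lam * weight B ⊤ Ss i
    ≡⟨ cong (lam *_) (weight-identity B ⊤ i r i+r≡s) ⟩
  lam * ((∣ B ∩ ⊤ ∣ C i) * ((∣ ⊤ {k} ∣ ∸ i) C r))
    ≡⟨ cong₂ (λ a b → lam * ((a C i) * ((b ∸ i) C r))) ∣B∩⊤∣≡t (∣⊤∣≡n k) ⟩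
  lam * ((t C i) * ((k ∸ i) C r))
    ≡⟨ x∙yz≈y∙xz lam (t C i) _ ⟩
  (t C i) * (lam * ((k ∸ i) C r)) ∎
  where
  open ≡-Reasoning
  Ss : List (Subset k)
  Ss = subsetsOfSize k s
  ∣B∩⊤∣≡t : ∣ B ∩ ⊤ ∣ ≡ t
  ∣B∩⊤∣≡t = trans (cong ∣_∣ (∩-identityʳ B)) ∣B∣≡t

module ℤ∑ = ListSum ℤP.+-*-commutativeSemiring

sgnℤ : ℕ → ℤ
sgnℤ i = -1ℤ ℤ.^ suc i

sgnℤ-odd : ∀ r → sgnℤ (2 * r + 1) ≡ 1ℤ
sgnℤ-odd zero    = refl
sgnℤ-odd (suc r) =
  trans (cong sgnℤ (cong (_+ 1) (*-suc 2 r))) (trans (-1*-1*x≡x (sgnℤ (2 * r + 1))) (sgnℤ-odd r))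
  where
  -1*-1*x≡x : ∀ x → -1ℤ ℤ.* (-1ℤ ℤ.* x) ≡ x
  -1*-1*x≡x = solve-∀

alternatingChooseSum : ℕ → ℕ → ℤ
alternatingChooseSum m a = ℤ∑.∑ (applyUpTo suc m) (λ i → sgnℤ i ℤ.* + (a C i))

∑-applyUpTo-suc : ∀ m (f : ℕ → ℤ) → ℤ∑.∑ (applyUpTo suc (suc m)) f ≡ ℤ∑.∑ (applyUpTo suc m) f ℤ.+ f (suc m)
∑-applyUpTo-suc m f =
  trans (cong (λ xs → ℤ∑.∑ xs f) (sym (applyUpTo-∷ʳ suc m))) (ℤ∑.∑-∷ʳ (applyUpTo suc m) (suc m) f)

alternatingChooseSum-0 : ∀ m → alternatingChooseSum m 0 ≡ 0ℤ
alternatingChooseSum-0 zero    = refl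
alternatingChooseSum-0 (suc m) = trans (∑-applyUpTo-suc m _)
  (cong₂ ℤ._+_ (alternatingChooseSum-0 m) (ℤP.*-zeroʳ (sgnℤ (suc m))))

alternatingChooseSum-suc : ∀ m a → alternatingChooseSum m (suc a) ≡ 1ℤ ℤ.+ sgnℤ m ℤ.* + (a C m)
alternatingChooseSum-suc zero    a = refl
alternatingChooseSum-suc (suc m) a = begin
  alternatingChooseSum (suc m) (suc a)
    ≡⟨ ∑-applyUpTo-suc m _ ⟩
  alternatingChooseSum m (suc a) ℤ.+ sgnℤ (suc m) ℤ.* + (suc a C suc m)
    ≡⟨ cong₂ (λ u v → u ℤ.+ sgnℤ (suc m) ℤ.* v) (alternatingChooseSum-suc m a) pascal ⟩
  1ℤ ℤ.+ sgnℤ m ℤ.* + (a C m) ℤ.+ (-1ℤ ℤ.* sgnℤ m) ℤ.* (+ (a C m) ℤ.+ + (a C suc m))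
    ≡⟨ telescope (sgnℤ m) (+ (a C m)) (+ (a C suc m)) ⟩
  1ℤ ℤ.+ sgnℤ (suc m) ℤ.* + (a C suc m) ∎
  where
  open ≡-Reasoning
  pascal : + (suc a C suc m) ≡ + (a C m) ℤ.+ + (a C suc m)
  pascal = trans (cong +_ (sym (nCk+nC[k+1]≡[n+1]C[k+1] a m))) (ℤP.pos-+ (a C m) (a C suc m))
  telescope : ∀ σ u v → 1ℤ ℤ.+ σ ℤ.* u ℤ.+ (-1ℤ ℤ.* σ) ℤ.* (u ℤ.+ v) ≡ 1ℤ ℤ.+ (-1ℤ ℤ.* σ) ℤ.* v
  telescope = solve-∀

pos-∑ : ∀ {a} {A : Set a} (xs : List A) f → + ∑ xs f ≡ ℤ∑.∑ xs (λ x → + f x)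
pos-∑ []       f = refl
pos-∑ (x ∷ xs) f = trans (ℤP.pos-+ (f x) (∑ xs f)) (cong (ℤ._+_ (+ f x)) (pos-∑ xs f))

ℤ∑-mono-≤ : ∀ {a} {A : Set a} (xs : List A) {f g : A → ℤ} → (∀ x → f x ℤ.≤ g x) → ℤ∑.∑ xs f ℤ.≤ ℤ∑.∑ xs g
ℤ∑-mono-≤ []       f≤g = ℤP.≤-refl
ℤ∑-mono-≤ (x ∷ xs) f≤g = ℤP.+-mono-≤ (f≤g x) (ℤ∑-mono-≤ xs f≤g)

signum≤alternatingChooseSum : ∀ r a → + signum a ℤ.≤ alternatingChooseSum (2 * r + 1) a
signum≤alternatingChooseSum r zero    = ℤP.≤-reflexive (sym (alternatingChooseSum-0 (2 * r + 1)))
signum≤alternatingChooseSum r (suc a) =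
  ℤP.≤-trans (ℤ.+≤+ (m≤m+n 1 c)) (ℤP.≤-reflexive (sym (begin
    alternatingChooseSum (2 * r + 1) (suc a) ≡⟨ alternatingChooseSum-suc (2 * r + 1) a ⟩
    1ℤ ℤ.+ sgnℤ (2 * r + 1) ℤ.* + c          ≡⟨ cong (λ σ → 1ℤ ℤ.+ σ ℤ.* + c) (sgnℤ-odd r) ⟩
    1ℤ ℤ.+ 1ℤ ℤ.* + c                        ≡⟨ cong (ℤ._+_ 1ℤ) (ℤP.*-identityˡ (+ c)) ⟩
    + (1 + c)                                 ∎)))
  where
  open ≡-Reasoning
  c : ℕ
  c = a C (2 * r + 1)

signum≡alternatingChooseSum : ∀ {m a} → a ≤ m → + signum a ≡ alternatingChooseSum m a
signum≡alternatingChooseSum {m} {zero}  _   = sym (alternatingChooseSum-0 m)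
signum≡alternatingChooseSum {m} {suc a} a<m = sym (begin
  alternatingChooseSum m (suc a)  ≡⟨ alternatingChooseSum-suc m a ⟩
  1ℤ ℤ.+ sgnℤ m ℤ.* + (a C m)     ≡⟨ cong (λ x → 1ℤ ℤ.+ sgnℤ m ℤ.* + x) (k>n⇒nCk≡0 a<m) ⟩
  1ℤ ℤ.+ sgnℤ m ℤ.* 0ℤ            ≡⟨ cong (ℤ._+_ 1ℤ) (ℤP.*-zeroʳ (sgnℤ m)) ⟩
  1ℤ                               ∎)
  where open ≡-Reasoning

toℚ : ℤ → ℚ
toℚ z = z ℚ./ 1

toℚ≃ : ∀ z → ℚ.toℚᵘ (toℚ z) ℚᵘ.≃ mkℚᵘ z 0
toℚ≃ z = ℚP.toℚᵘ-fromℚᵘ (mkℚᵘ z 0)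

toℚ-+ : ∀ a b → toℚ (a ℤ.+ b) ≡ toℚ a ℚ.+ toℚ b
toℚ-+ a b = ℚP.toℚᵘ-injective (begin
  ℚ.toℚᵘ (toℚ (a ℤ.+ b))               ≈⟨ toℚ≃ (a ℤ.+ b) ⟩
  mkℚᵘ (a ℤ.+ b) 0                     ≈⟨ *≡* (ring a b) ⟩
  mkℚᵘ a 0 ℚᵘ.+ mkℚᵘ b 0               ≈⟨ ℚᵘP.+-cong (toℚ≃ a) (toℚ≃ b) ⟨
  ℚ.toℚᵘ (toℚ a) ℚᵘ.+ ℚ.toℚᵘ (toℚ b)   ≈⟨ ℚP.toℚᵘ-homo-+ (toℚ a) (toℚ b) ⟨
  ℚ.toℚᵘ (toℚ a ℚ.+ toℚ b)             ∎)
  where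
  open ≃-Reasoning
  ring : ∀ a b → (a ℤ.+ b) ℤ.* 1ℤ ≡ (a ℤ.* 1ℤ ℤ.+ b ℤ.* 1ℤ) ℤ.* 1ℤ
  ring = solve-∀

toℚ-* : ∀ a b → toℚ (a ℤ.* b) ≡ toℚ a ℚ.* toℚ b
toℚ-* a b = ℚP.toℚᵘ-injective (begin
  ℚ.toℚᵘ (toℚ (a ℤ.* b))               ≈⟨ toℚ≃ (a ℤ.* b) ⟩
  mkℚᵘ a 0 ℚᵘ.* mkℚᵘ b 0               ≈⟨ ℚᵘP.*-cong (toℚ≃ a) (toℚ≃ b) ⟨
  ℚ.toℚᵘ (toℚ a) ℚᵘ.* ℚ.toℚᵘ (toℚ b)   ≈⟨ ℚP.toℚᵘ-homo-* (toℚ a) (toℚ b) ⟨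
  ℚ.toℚᵘ (toℚ a ℚ.* toℚ b)             ∎)
  where open ≃-Reasoning

toℚ-mono-≤ : ∀ {a b} → a ℤ.≤ b → toℚ a ℚ.≤ toℚ b
toℚ-mono-≤ {a} {b} a≤b = ℚP.toℚᵘ-cancel-≤
  (ℚᵘP.≤-respˡ-≃ (ℚᵘP.≃-sym (toℚ≃ a)) (ℚᵘP.≤-respʳ-≃ (ℚᵘP.≃-sym (toℚ≃ b))
    (*≤* (subst₂ ℤ._≤_ (sym (ℤP.*-identityʳ a)) (sym (ℤP.*-identityʳ b)) a≤b))))

sum1to-toℚ : ∀ m (g : ℕ → ℤ) → sum1to m (λ i → toℚ (g i)) ≡ toℚ (ℤ∑.∑ (applyUpTo suc m) g)
sum1to-toℚ zero    g = refl
sum1to-toℚ (suc m) g = begin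
  sum1to m (λ i → toℚ (g i)) ℚ.+ toℚ (g (suc m))   ≡⟨ cong (ℚ._+ toℚ (g (suc m))) (sum1to-toℚ m g) ⟩
  toℚ (ℤ∑.∑ (applyUpTo suc m) g) ℚ.+ toℚ (g (suc m)) ≡⟨ toℚ-+ (ℤ∑.∑ (applyUpTo suc m) g) (g (suc m)) ⟨
  toℚ (ℤ∑.∑ (applyUpTo suc m) g ℤ.+ g (suc m))      ≡⟨ cong toℚ (∑-applyUpTo-suc m g) ⟨
  toℚ (ℤ∑.∑ (applyUpTo suc (suc m)) g)              ∎
  where open ≡-Reasoning

sum1to-cong : ∀ m {f g : ℕ → ℚ} → (∀ {i} → 1 ≤ i → i ≤ m → f i ≡ g i) → sum1to m f ≡ sum1to m g
sum1to-cong zero    f≡g = refl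
sum1to-cong (suc m) f≡g =
  cong₂ ℚ._+_ (sum1to-cong m (λ 1≤i i≤m → f≡g 1≤i (m≤n⇒m≤1+n i≤m))) (f≡g (s≤s z≤n) ≤-refl)

[n+c]d≡cx⇒c[x/d-1]≡n : ∀ {n c x d} → 0 < d → (n + c) * d ≡ c * x →
                       toℚ (+ c) ℚ.* (frac x d ℚ.- 1ℚ) ≡ toℚ (+ n)
[n+c]d≡cx⇒c[x/d-1]≡n {n} {c} {x} {suc d} _ eq = ℚP.toℚᵘ-injective (begin
  ℚ.toℚᵘ (toℚ (+ c) ℚ.* ((+ x) ℚ./ suc d ℚ.- 1ℚ))
    ≈⟨ ℚP.toℚᵘ-homo-* (toℚ (+ c)) _ ⟩
  ℚ.toℚᵘ (toℚ (+ c)) ℚᵘ.* ℚ.toℚᵘ ((+ x) ℚ./ suc d ℚ.- 1ℚ)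
    ≈⟨ ℚᵘP.*-cong (toℚ≃ (+ c)) (ℚᵘP.≃-trans (ℚP.toℚᵘ-homo-+ ((+ x) ℚ./ suc d) (ℚ.- 1ℚ))
                                 (ℚᵘP.+-cong (ℚP.toℚᵘ-fromℚᵘ (mkℚᵘ (+ x) d)) (ℚP.toℚᵘ-homo‿- 1ℚ))) ⟩
  mkℚᵘ (+ c) 0 ℚᵘ.* (mkℚᵘ (+ x) d ℚᵘ.- ℚᵘ.1ℚᵘ)
    -- the denominator of this ℚᵘ product is suc (d * 1 + 0 * _), not suc d
    ≈⟨ *≡* (trans (cross-multiply (+ c) (+ n) (+ x) (+ suc d) eqℤ)
                  (cong (λ e → + n ℤ.* + suc e) (sym (trans (+-identityʳ (d * 1)) (*-identityʳ d))))) ⟩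
  mkℚᵘ (+ n) 0
    ≈⟨ toℚ≃ (+ n) ⟨
  ℚ.toℚᵘ (toℚ (+ n)) ∎)
  where
  open ≃-Reasoning
  eqℤ : (+ n ℤ.+ + c) ℤ.* + suc d ≡ + c ℤ.* + x
  eqℤ = trans (cong (ℤ._* + suc d) (sym (ℤP.pos-+ n c)))
              (trans (sym (ℤP.pos-* (n + c) (suc d))) (trans (cong +_ eq) (ℤP.pos-* c x)))
  cross-multiply : ∀ c n x D → (n ℤ.+ c) ℤ.* D ≡ c ℤ.* x →
                   (c ℤ.* (x ℤ.* 1ℤ ℤ.+ ℤ.- 1ℤ ℤ.* D)) ℤ.* 1ℤ ≡ n ℤ.* D
  cross-multiply c n x D h = trans (expand c x D) (trans (cong (ℤ._- c ℤ.* D) (sym h)) (cancel c n D))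
    where
    expand : ∀ c x D → (c ℤ.* (x ℤ.* 1ℤ ℤ.+ ℤ.- 1ℤ ℤ.* D)) ℤ.* 1ℤ ≡ c ℤ.* x ℤ.- c ℤ.* D
    expand = solve-∀
    cancel : ∀ c n D → (n ℤ.+ c) ℤ.* D ℤ.- c ℤ.* D ≡ n ℤ.* D
    cancel = solve-∀

nCk>0 : ∀ {n k} → k ≤ n → 0 < n C k
nCk>0 {n}     {zero}  _         = s≤s z≤n
nCk>0 {suc n} {suc k} (s≤s k≤n) =
  subst (0 <_) (nCk+nC[k+1]≡[n+1]C[k+1] n k) (≤-trans (nCk>0 k≤n) (m≤m+n _ _))

[1+n]Cn≡1+n : ∀ n → suc n C n ≡ suc n
[1+n]Cn≡1+n n = trans (nCk≡nC[n∸k] (n≤1+n n)) (trans (cong (suc n C_) (m+n∸n≡m 1 n)) (nC1≡n (suc n)))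

term′≡term : ∀ k t lam {i} → 1 ≤ i → i ≤ t ∸ 1 → term′ k t lam i ≡ term (t ∸ 1) k t lam i
term′≡term k zero    lam () z≤n
term′≡term k (suc t) lam {i} _ i≤t =
  cong (λ D → sgn i ℚ.* toℚ (+ (suc t C i)) ℚ.* (frac (lam * ((k ∸ i) C (t ∸ i))) D ℚ.- 1ℚ))
       (sym denominator)
  where
  denominator : (suc t ∸ i) C (t ∸ i) ≡ suc t ∸ i
  denominator = begin
    (suc t ∸ i) C (t ∸ i) ≡⟨ cong (_C (t ∸ i)) (+-∸-assoc 1 i≤t) ⟩
    suc (t ∸ i) C (t ∸ i) ≡⟨ [1+n]Cn≡1+n (t ∸ i) ⟩
    suc (t ∸ i)           ≡⟨ +-∸-assoc 1 i≤t ⟨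
    suc t ∸ i             ∎
    where open ≡-Reasoning

2*⌊n/2⌋≤n : ∀ n → 2 * ⌊ n /2⌋ ≤ n
2*⌊n/2⌋≤n zero          = z≤n
2*⌊n/2⌋≤n (suc zero)    = z≤n
2*⌊n/2⌋≤n (suc (suc n)) = subst (_≤ suc (suc n)) (sym (*-suc 2 ⌊ n /2⌋)) (s≤s (s≤s (2*⌊n/2⌋≤n n)))

2*⌊[s∸1]/2⌋+1≤s : ∀ {s} → 1 ≤ s → 2 * ⌊ (s ∸ 1) /2⌋ + 1 ≤ s
2*⌊[s∸1]/2⌋+1≤s {suc s} _ = subst (_≤ suc s) (+-comm 1 (2 * ⌊ s /2⌋)) (s≤s (2*⌊n/2⌋≤n s))

All-removeAt : ∀ {a p} {A : Set a} {P : A → Set p} {xs : List A} →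
               All P xs → (j : Fin (length xs)) → All P (removeAt xs j)
All-removeAt (px ∷ pxs) zero    = pxs
All-removeAt (px ∷ pxs) (suc j) = px ∷ All-removeAt pxs j

Unique⇒removeAt-≢ : ∀ {a} {A : Set a} {xs : List A} → Unique xs →
                    (j : Fin (length xs)) → All (_≢ lookup xs j) (removeAt xs j)
Unique⇒removeAt-≢ (x≢xs ∷ _)      zero    = All.map ≢-sym x≢xs
Unique⇒removeAt-≢ (x≢xs ∷ unique) (suc j) =
  All.lookup x≢xs (∈-lookup j) ∷ Unique⇒removeAt-≢ unique j

module BlockDegree {s k t lam} {𝓑 : List (Subset k)} (design : IsDesign s k t lam 𝓑)
                   (s≤t : s ≤ t) (j : Fin (length 𝓑)) where

  private
    B : Subset k
    B = lookup 𝓑 j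

    others : List (Subset k)
    others = removeAt 𝓑 j

    meet : Subset k → ℕ
    meet B′ = ∣ B ∩ B′ ∣

    shared : ℕ → ℕ
    shared i = ∑ others (λ B′ → meet B′ C i)

    ∣B∣≡t : ∣ B ∣ ≡ t
    ∣B∣≡t = All.lookup (proj₁ design) (∈-lookup j)

    shared-count : ∀ {i} → i ≤ s →
                   (shared i + t C i) * ((t ∸ i) C (s ∸ i)) ≡ (t C i) * (lam * ((k ∸ i) C (s ∸ i)))
    shared-count {i} i≤s = trans (cong (_* ((t ∸ i) C (s ∸ i))) all-blocks)
                                 (design-intersections design {B} ∣B∣≡t i (s ∸ i) (m+[n∸m]≡n i≤s))
      where
      all-blocks : shared i + t C i ≡ ∑ 𝓑 (λ B′ → meet B′ C i)
      all-blocks = trans (+-comm (shared i) (t C i)) (sym (trans (∑-removeAt 𝓑 j (λ B′ → meet B′ C i))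
                     (cong (λ a → a C i + shared i) (trans (cong ∣_∣ (∩-idem B)) ∣B∣≡t))))

    term≡toℚ : ∀ {i} → i ≤ s → term s k t lam i ≡ toℚ (sgnℤ i ℤ.* + shared i)
    term≡toℚ {i} i≤s = begin
      term s k t lam i
        ≡⟨ ℚP.*-assoc (sgn i) (toℚ (+ (t C i))) _ ⟩
      sgn i ℚ.* (toℚ (+ (t C i)) ℚ.* (frac (lam * ((k ∸ i) C (s ∸ i))) ((t ∸ i) C (s ∸ i)) ℚ.- 1ℚ))
        ≡⟨ cong (sgn i ℚ.*_) ([n+c]d≡cx⇒c[x/d-1]≡n {n = shared i} {c = t C i}
                                (nCk>0 (∸-monoˡ-≤ i s≤t)) (shared-count i≤s)) ⟩
      toℚ (sgnℤ i) ℚ.* toℚ (+ shared i)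
        ≡⟨ toℚ-* (sgnℤ i) (+ shared i) ⟨
      toℚ (sgnℤ i ℤ.* + shared i) ∎
      where open ≡-Reasoning

    sum1to-term : ∀ {m} → m ≤ s →
                  sum1to m (term s k t lam) ≡ toℚ (ℤ∑.∑ others (λ B′ → alternatingChooseSum m (meet B′)))
    sum1to-term {m} m≤s = begin
      sum1to m (term s k t lam)
        ≡⟨ sum1to-cong m (λ _ i≤m → term≡toℚ (≤-trans i≤m m≤s)) ⟩
      sum1to m (λ i → toℚ (sgnℤ i ℤ.* + shared i))
        ≡⟨ sum1to-toℚ m _ ⟩
      toℚ (ℤ∑.∑ (applyUpTo suc m) (λ i → sgnℤ i ℤ.* + shared i))
        ≡⟨ cong toℚ (ℤ∑.∑-cong (applyUpTo suc m) distribute) ⟩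
      toℚ (ℤ∑.∑ (applyUpTo suc m) (λ i → ℤ∑.∑ others (λ B′ → sgnℤ i ℤ.* + (meet B′ C i))))
        ≡⟨ cong toℚ (ℤ∑.∑-swap (applyUpTo suc m) others _) ⟩
      toℚ (ℤ∑.∑ others (λ B′ → alternatingChooseSum m (meet B′))) ∎
      where
      open ≡-Reasoning
      distribute : ∀ i → sgnℤ i ℤ.* + shared i ≡ ℤ∑.∑ others (λ B′ → sgnℤ i ℤ.* + (meet B′ C i))
      distribute i = trans (cong (sgnℤ i ℤ.*_) (pos-∑ others (λ B′ → meet B′ C i)))
                           (sym (ℤ∑.∑-*ˡ (sgnℤ i) others _))

    degree≡∑signum : + degree 𝓑 j ≡ ℤ∑.∑ others (λ B′ → + signum (meet B′))
    degree≡∑signum = trans (cong +_ (trans (length-filter≡∑indicator _ others)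
                                    (∑-cong others (λ B′ → indicator-nonempty (B ∩ B′)))))
                    (pos-∑ others _)

  degree≤sum1to-odd : ∀ m → ∃ (λ r → m ≡ 2 * r + 1) → m ≤ s →
                      toℚ (+ degree 𝓑 j) ℚ.≤ sum1to m (term s k t lam)
  degree≤sum1to-odd m (r , refl) m≤s = begin
    toℚ (+ degree 𝓑 j)
      ≡⟨ cong toℚ degree≡∑signum ⟩
    toℚ (ℤ∑.∑ others (λ B′ → + signum (meet B′)))
      ≤⟨ toℚ-mono-≤ (ℤ∑-mono-≤ others (λ B′ → signum≤alternatingChooseSum r (meet B′))) ⟩
    toℚ (ℤ∑.∑ others (λ B′ → alternatingChooseSum m (meet B′)))
      ≡⟨ sum1to-term m≤s ⟨
    sum1to m (term s k t lam) ∎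
    where open ℚP.≤-Reasoning

  degree≡sum1to-t∸1 : s ≡ t ∸ 1 → Unique 𝓑 → toℚ (+ degree 𝓑 j) ≡ sum1to (t ∸ 1) (term′ k t lam)
  degree≡sum1to-t∸1 refl unique = sym (begin
    sum1to (t ∸ 1) (term′ k t lam)
      ≡⟨ sum1to-cong (t ∸ 1) (term′≡term k t lam) ⟩
    sum1to (t ∸ 1) (term (t ∸ 1) k t lam)
      ≡⟨ sum1to-term ≤-refl ⟩
    toℚ (ℤ∑.∑ others (λ B′ → alternatingChooseSum (t ∸ 1) (meet B′)))
      ≡⟨ cong toℚ (ℤ∑.∑-congᴬ meet≤t∸1 (λ meet≤ → sym (signum≡alternatingChooseSum meet≤))) ⟩
    toℚ (ℤ∑.∑ others (λ B′ → + signum (meet B′)))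
      ≡⟨ cong toℚ degree≡∑signum ⟨
    toℚ (+ degree 𝓑 j) ∎)
    where
    open ≡-Reasoning
    meet<t : ∀ {B′} → ∣ B′ ∣ ≡ t × B′ ≢ B → meet B′ < t
    meet<t {B′} (∣B′∣≡t , B′≢B) = ≤∧≢⇒< (subst (meet B′ ≤_) ∣B∣≡t (∣p∩q∣≤∣p∣ B B′)) λ meet≡t →
      B′≢B (sym (∣p∩q∣≡∣p∣≡∣q∣⇒p≡q B B′ (trans meet≡t (sym ∣B∣≡t)) (trans meet≡t (sym ∣B′∣≡t))))
    meet≤t∸1 : All (λ B′ → meet B′ ≤ t ∸ 1) others
    meet≤t∸1 = All.zipWith (λ p → ∸-monoˡ-≤ 1 (meet<t p))
                            (All-removeAt (proj₁ design) j , Unique⇒removeAt-≢ unique j)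

lemma1 : (s k t lam : ℕ) → 1 ≤ s → s ≤ t →
         (𝓑 : List (Subset k)) → IsDesign s k t lam 𝓑 →
         (j : Fin (length 𝓑)) →
         ((((+ degree 𝓑 j) ℚ./ 1) ℚ.≤ sum1to (2 * ⌊ (s ∸ 1) /2⌋ + 1) (term s k t lam))
         × ((m : ℕ) → ∃ (λ r → m ≡ 2 * r + 1) → 1 ≤ m → m ≤ s →
               ((+ degree 𝓑 j) ℚ./ 1) ℚ.≤ sum1to m (term s k t lam))
         × (s ≡ t ∸ 1 → Unique 𝓑 →
               ((+ degree 𝓑 j) ℚ./ 1) ≡ sum1to (t ∸ 1) (term′ k t lam)))
lemma1 s k t lam 1≤s s≤t 𝓑 design j =
  degree≤sum1to-odd _ (⌊ (s ∸ 1) /2⌋ , refl) (2*⌊[s∸1]/2⌋+1≤s 1≤s) ,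
  (λ m odd _ m≤s → degree≤sum1to-odd m odd m≤s) ,
  degree≡sum1to-t∸1
  where open BlockDegree design s≤t j
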